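{- (i) $P_4 \Box P_4$ is efficiently dominatable. (ii) $P_5 \Box P_5$ is not efficiently dominatable and $F(P_5 \Box P_5) = 23$. (iii) $P_6 \Box P_6$ is not efficiently dominatable and $F(P_6 \Box P_6) = 33$.
   Context: For a graph $G$ and vertex $v$, $N[v]$ denotes the closed neighborhood of $v$. A set $S\subseteq V(G)$ is a 2-packing if $|N[x]\cap S|\le 1$ for all $x\in V(G)$. The efficient domination number is $F(G)=\max\{\sum_{v\in S}(1+\deg v) : S \text{ a 2-packing of } G\}$. $G$ is efficiently dominatable if it has a set $S$ with $|N[v]\cap S|=1$ for all $v\in V(G)$, equivalently $F(G)=|V(G)|$. $P_n\Box P_n$ denotes the Cartesian product of two paths on $n$ vertices (the $n\times n$ grid graph). -}

module Defs where

open import Data.Nat using (ℕ; zero; suc; _+_; _*_; _≤_; _≡ᵇ_)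
open import Data.Bool using (Bool; true; false; _∧_; _∨_; if_then_else_)
open import Data.Fin using (Fin; toℕ; remQuot; _≟_)
open import Data.Product using (_×_; _,_; proj₁; proj₂; Σ; ∃)
open import Data.Vec using (tabulate; sum)
open import Relation.Nullary.Decidable using (⌊_⌋)
open import Relation.Binary.PropositionalEquality using (_≡_)

record Graph : Set where
  field
    V   : ℕ
    Adj : Fin V → Fin V → Bool
open Graph public

VSet : Graph → Set
VSet G = Fin (V G) → Bool

count : {n : ℕ} → (Fin n → Bool) → ℕ
count p = sum (tabulate (λ i → if p i then 1 else 0))

closedNbhd : (G : Graph) → Fin (V G) → VSet G
closedNbhd G v u = ⌊ u ≟ v ⌋ ∨ Adj G v u

deg : (G : Graph) → Fin (V G) → ℕ
deg G v = count (Adj G v)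

nbhdCount : (G : Graph) → VSet G → Fin (V G) → ℕ
nbhdCount G S x = count (λ u → closedNbhd G x u ∧ S u)

IsTwoPacking : (G : Graph) → VSet G → Set
IsTwoPacking G S = ∀ x → nbhdCount G S x ≤ 1

weight : (G : Graph) → VSet G → ℕ
weight G S = sum (tabulate (λ v → if S v then suc (deg G v) else 0))

EffDomNumberIs : Graph → ℕ → Set
EffDomNumberIs G k =
  Σ (VSet G) (λ S → IsTwoPacking G S × weight G S ≡ k)
  × (∀ S → IsTwoPacking G S → weight G S ≤ k)

EfficientlyDominatable : Graph → Set
EfficientlyDominatable G = Σ (VSet G) (λ S → ∀ v → nbhdCount G S v ≡ 1)

Path : ℕ → Graph
Path n = record
  { V = n
  ; Adj = λ i j → (suc (toℕ i) ≡ᵇ toℕ j) ∨ (suc (toℕ j) ≡ᵇ toℕ i) }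

_□_ : Graph → Graph → Graph
G □ H = record
  { V = V G * V H
  ; Adj = λ p q → adj (remQuot (V H) p) (remQuot (V H) q) }
  where
  adj : Fin (V G) × Fin (V H) → Fin (V G) × Fin (V H) → Bool
  adj (g , h) (g' , h') =
    (⌊ g ≟ g' ⌋ ∧ Adj H h h') ∨ (⌊ h ≟ h' ⌋ ∧ Adj G g g')

-- Double counting the pairs (v, x) with v ∈ S and x ∈ N[v] gives, for a simple graph,
-- Σ_{v ∈ S} (1 + deg v) = Σ_x |N[x] ∩ S|.  For a 2-packing the right-hand side is at most
-- |V|, with equality for an efficient dominating set, so a graph with F(G) < |V| is not
-- efficiently dominatable.  F(P₅ □ P₅) = 23 and F(P₆ □ P₆) = 33 are attained by explicit
-- packings; the matching upper bounds come from an exhaustive search over all sets of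
-- vertices no two of which share a closed neighbour, which are exactly the 2-packings.
module Submission where

open import Defs
open import Data.Bool using (Bool; true; false; T; not; _∧_; _∨_; if_then_else_)
open import Data.Bool.ListAction using (any)
open import Data.Bool.Properties using (T?; T-∧; ∨-comm; ∧-identityʳ; ∧-zeroʳ)
open import Data.Empty using (⊥; ⊥-elim)
open import Data.Fin using (Fin; zero; suc; toℕ; _≟_; remQuot; combine; #_)
open import Data.Fin.Properties using (any?; all?)
open import Data.List as List using (List; []; _∷_)
open import Data.List.Relation.Unary.All using (All; []; _∷_; lookupWith)
open import Data.List.Relation.Unary.All.Properties using (map⁺)
open import Data.List.Relation.Unary.Any.Properties using (any⁻)
open import Data.Nat as ℕ using (ℕ; zero; suc; _+_; _⊔_; _≤_; _<_; _≤?_; z≤n; s≤s; z<s; _≡ᵇ_)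
open import Data.Nat.Properties
  using (+-0-commutativeMonoid; ≤-trans; ≤-reflexive; m≤n+m; m≤m⊔n; m≤n⊔m; +-monoʳ-≤; +-suc; <⇒≱; m<m+n)
open import Algebra.Properties.CommutativeMonoid.Sum +-0-commutativeMonoid
  using (∑-comm; sum-cong-≗; sum-syntax)
open import Data.Product using (_×_; _,_; ∃)
open import Data.Vec using (Vec; []; _∷_; lookup; map; tabulate; allFin; sum)
open import Data.Vec.Properties using (lookup-map; tabulate-cong; tabulate-allFin)
open import Function using (_∘_; Equivalence)
open import Relation.Nullary using (¬_)
open import Relation.Nullary.Decidable using (Dec; ⌊_⌋; yes; no; toWitness; toWitnessFalse)
open import Relation.Binary.PropositionalEquality
  using (_≡_; _≢_; _≗_; refl; sym; trans; cong; cong₂; subst; module ≡-Reasoning)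

sum-tabulate : ∀ {n} (f : Fin n → ℕ) → sum (tabulate f) ≡ ∑[ i < n ] f i
sum-tabulate {zero}  f = refl
sum-tabulate {suc n} f = cong (f zero +_) (sum-tabulate (f ∘ suc))

∑-ones : ∀ n → ∑[ i < n ] 1 ≡ n
∑-ones zero    = refl
∑-ones (suc n) = cong suc (∑-ones n)

count-∑ : ∀ {n} (p : Fin n → Bool) → count p ≡ ∑[ i < n ] (if p i then 1 else 0)
count-∑ p = sum-tabulate (λ i → if p i then 1 else 0)

count-cong : ∀ {n} {p q : Fin n → Bool} → p ≗ q → count p ≡ count q
count-cong p≗q = cong sum (tabulate-cong (cong (λ b → if b then 1 else 0) ∘ p≗q))

count-false : ∀ n → count {n} (λ _ → false) ≡ 0
count-false zero    = refl
count-false (suc n) = count-false n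

count-pos : ∀ {n} (p : Fin n → Bool) {u} → T (p u) → 1 ≤ count p
count-pos p {zero} pu with p zero
... | true = s≤s z≤n
count-pos p {suc u} pu = ≤-trans (count-pos (p ∘ suc) pu) (m≤n+m _ _)

count-head+tail : ∀ {n} (p : Fin (suc n) → Bool) {v} → T (p zero) → T (p (suc v)) → 2 ≤ count p
count-head+tail p p0 pv with p zero
... | true = s≤s (count-pos (p ∘ suc) pv)

count≤1⇒unique : ∀ {n} (p : Fin n → Bool) {u v} → count p ≤ 1 → T (p u) → T (p v) → u ≡ v
count≤1⇒unique p {zero}  {zero}  _   _  _  = refl
count≤1⇒unique p {zero}  {suc v} c≤1 pu pv = ⊥-elim (<⇒≱ (count-head+tail p pu pv) c≤1)
count≤1⇒unique p {suc u} {zero}  c≤1 pu pv = ⊥-elim (<⇒≱ (count-head+tail p pv pu) c≤1)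
count≤1⇒unique p {suc u} {suc v} c≤1 pu pv =
  cong suc (count≤1⇒unique (p ∘ suc) (≤-trans (m≤n+m _ _) c≤1) pu pv)

⌊suc≟suc⌋ : ∀ {n} (i j : Fin n) → ⌊ suc i ≟ suc j ⌋ ≡ ⌊ i ≟ j ⌋
⌊suc≟suc⌋ i j with i ≟ j
... | yes _ = refl
... | no _  = refl

count-insert : ∀ {n} (p : Fin n → Bool) {v} → p v ≡ false →
  count (λ x → ⌊ v ≟ x ⌋ ∨ p x) ≡ suc (count p)
count-insert p {zero} pv rewrite pv = refl
count-insert p {suc v} pv = begin
  (if p zero then 1 else 0) + count (λ x → ⌊ suc v ≟ suc x ⌋ ∨ p (suc x))
    ≡⟨ cong ((if p zero then 1 else 0) +_)
            (count-cong λ x → cong (_∨ p (suc x)) (⌊suc≟suc⌋ v x)) ⟩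
  (if p zero then 1 else 0) + count (λ x → ⌊ v ≟ x ⌋ ∨ p (suc x))
    ≡⟨ cong ((if p zero then 1 else 0) +_) (count-insert (p ∘ suc) pv) ⟩
  (if p zero then 1 else 0) + suc (count (p ∘ suc))
    ≡⟨ +-suc _ _ ⟩
  suc (count p) ∎
  where open ≡-Reasoning

record IsSimple (G : Graph) : Set where
  field
    symmetric : ∀ u v → Adj G u v ≡ Adj G v u
    loopless  : ∀ v → Adj G v v ≡ false

suc≡ᵇ-false : ∀ m → (suc m ≡ᵇ m) ≡ false
suc≡ᵇ-false zero    = refl
suc≡ᵇ-false (suc m) = suc≡ᵇ-false m

path-isSimple : ∀ n → IsSimple (Path n)
path-isSimple n = record
  { symmetric = λ i j → ∨-comm (suc (toℕ i) ≡ᵇ toℕ j) _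
  ; loopless  = λ i → cong₂ _∨_ (suc≡ᵇ-false (toℕ i)) (suc≡ᵇ-false (toℕ i))
  }

≟-sym : ∀ {n} (i j : Fin n) → ⌊ i ≟ j ⌋ ≡ ⌊ j ≟ i ⌋
≟-sym i j with i ≟ j | j ≟ i
... | yes _   | yes _   = refl
... | no _    | no _    = refl
... | yes i≡j | no j≢i  = ⊥-elim (j≢i (sym i≡j))
... | no i≢j  | yes j≡i = ⊥-elim (i≢j (sym j≡i))

□-isSimple : ∀ {G H} → IsSimple G → IsSimple H → IsSimple (G □ H)
□-isSimple {G} {H} sG sH = record
  { symmetric = λ p q → symmetric′ (remQuot (V H) p) (remQuot (V H) q)
  ; loopless  = λ p → loopless′ (remQuot (V H) p)
  }
  where
  open IsSimple
  adj : Fin (V G) × Fin (V H) → Fin (V G) × Fin (V H) → Bool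
  adj (g , h) (g′ , h′) = (⌊ g ≟ g′ ⌋ ∧ Adj H h h′) ∨ (⌊ h ≟ h′ ⌋ ∧ Adj G g g′)

  symmetric′ : ∀ x y → adj x y ≡ adj y x
  symmetric′ (g , h) (g′ , h′) =
    cong₂ _∨_ (cong₂ _∧_ (≟-sym g g′) (symmetric sH h h′))
              (cong₂ _∧_ (≟-sym h h′) (symmetric sG g g′))

  ∧-false : ∀ a {b} → b ≡ false → a ∧ b ≡ false
  ∧-false a refl = ∧-zeroʳ a

  loopless′ : ∀ x → adj x x ≡ false
  loopless′ (g , h) =
    cong₂ _∨_ (∧-false ⌊ g ≟ g ⌋ (loopless sH h)) (∧-false ⌊ h ≟ h ⌋ (loopless sG g))

module _ {G : Graph} (simple : IsSimple G) where
  open IsSimple simple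

  count-closedNbhd : ∀ v → count (λ x → closedNbhd G x v) ≡ suc (deg G v)
  count-closedNbhd v = trans (count-cong λ x → cong (⌊ v ≟ x ⌋ ∨_) (symmetric x v))
                             (count-insert (Adj G v) (loopless v))

  weight≡∑nbhdCount : ∀ S → weight G S ≡ ∑[ x < V G ] nbhdCount G S x
  weight≡∑nbhdCount S = begin
    weight G S
      ≡⟨ sum-tabulate (λ v → if S v then suc (deg G v) else 0) ⟩
    ∑[ v < V G ] (if S v then suc (deg G v) else 0)
      ≡⟨ sum-cong-≗ (λ v → trans (contribution v)
                                  (count-∑ (λ x → closedNbhd G x v ∧ S v))) ⟩
    ∑[ v < V G ] ∑[ x < V G ] (if closedNbhd G x v ∧ S v then 1 else 0)
      ≡⟨ ∑-comm (λ v x → if closedNbhd G x v ∧ S v then 1 else 0) ⟩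
    ∑[ x < V G ] ∑[ v < V G ] (if closedNbhd G x v ∧ S v then 1 else 0)
      ≡⟨ sum-cong-≗ (λ x → sym (count-∑ (λ v → closedNbhd G x v ∧ S v))) ⟩
    ∑[ x < V G ] nbhdCount G S x ∎
    where
    open ≡-Reasoning
    contribution : ∀ v → (if S v then suc (deg G v) else 0) ≡ count (λ x → closedNbhd G x v ∧ S v)
    contribution v with S v
    ... | true  = sym (trans (count-cong λ x → ∧-identityʳ (closedNbhd G x v)) (count-closedNbhd v))
    ... | false = sym (trans (count-cong λ x → ∧-zeroʳ (closedNbhd G x v)) (count-false (V G)))

  efficientlyDominatable⇒V≤ : EfficientlyDominatable G → ∀ {k} →
    (∀ S → IsTwoPacking G S → weight G S ≤ k) → V G ≤ k
  efficientlyDominatable⇒V≤ (S , exact) {k} bound =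
    subst (_≤ k) weight≡V (bound S (≤-reflexive ∘ exact))
    where
    weight≡V : weight G S ≡ V G
    weight≡V = trans (weight≡∑nbhdCount S) (trans (sum-cong-≗ exact) (∑-ones (V G)))

-- A search plan over a history of k earlier yes/no choices, most recent first: each step
-- carries the weight of the next element and the positions in the history of the earlier
-- elements it clashes with, so that a node of the search costs only a few lookups.
data Plan : ℕ → Set where
  []   : ∀ {k} → Plan k
  step : ∀ {k} → ℕ → List (Fin k) → Plan (suc k) → Plan k

maxWeight : ∀ {k} → Plan k → Vec Bool k → ℕ
maxWeight []                chosen = 0
maxWeight (step w is rest) chosen =
  maxWeight rest (false ∷ chosen)
  ⊔ (if any (lookup chosen) is then 0 else w + maxWeight rest (true ∷ chosen))

module _ {A : Set} (clash : A → A → Bool) where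

  ClashFree : (A → Bool) → Set
  ClashFree S = ∀ {u v} → T (clash u v) → T (S u) → T (S v) → ⊥

  clashIndices : ∀ {k} → A → Vec A k → List (Fin k)
  clashIndices v []       = []
  clashIndices v (u ∷ us) =
    if clash u v then zero ∷ List.map suc (clashIndices v us) else List.map suc (clashIndices v us)

  clashIndices-clash : ∀ {k} v (us : Vec A k) →
    All (λ i → T (clash (lookup us i) v)) (clashIndices v us)
  clashIndices-clash v []       = []
  clashIndices-clash v (u ∷ us) with clash u v in eq
  ... | true  = subst T (sym eq) _ ∷ map⁺ (clashIndices-clash v us)
  ... | false = map⁺ (clashIndices-clash v us)

  clashIndices-unchosen : ∀ {S} → ClashFree S → ∀ {k v} (earlier : Vec A k) → T (S v) →
    any (lookup (map S earlier)) (clashIndices v earlier) ≡ false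
  clashIndices-unchosen {S} clashFree {v = v} earlier Sv
    with any (lookup (map S earlier)) (clashIndices v earlier) in eq
  ... | false = refl
  ... | true  = ⊥-elim (lookupWith
    (λ {i} clashes chosen → clashFree clashes (subst T (lookup-map i S earlier) chosen) Sv)
    (clashIndices-clash v earlier)
    (any⁻ (lookup (map S earlier)) (clashIndices v earlier) (subst T (sym eq) _)))

  module _ (w : A → ℕ) where

    plan : ∀ {k m} → Vec A k → Vec A m → Plan k
    plan earlier []       = []
    plan earlier (v ∷ vs) = step (w v) (clashIndices v earlier) (plan (v ∷ earlier) vs)

    selectedWeight : ∀ {m} → (A → Bool) → Vec A m → ℕ
    selectedWeight S vs = sum (map (λ v → if S v then w v else 0) vs)

    selectedWeight≤maxWeight : ∀ {S} → ClashFree S → ∀ {k m} (earlier : Vec A k) (vs : Vec A m) →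
      selectedWeight S vs ≤ maxWeight (plan earlier vs) (map S earlier)
    selectedWeight≤maxWeight clashFree earlier [] = z≤n
    selectedWeight≤maxWeight {S} clashFree earlier (v ∷ vs)
      with S v in eq | selectedWeight≤maxWeight clashFree (v ∷ earlier) vs
    ... | false | bound = ≤-trans bound (m≤m⊔n _ _)
    ... | true  | bound rewrite clashIndices-unchosen clashFree {v = v} earlier (subst T (sym eq) _) =
      ≤-trans (+-monoʳ-≤ (w v) bound) (m≤n⊔m _ _)

packingClash : (G : Graph) → Fin (V G) → Fin (V G) → Bool
packingClash G u v =
  not ⌊ u ≟ v ⌋ ∧ ⌊ any? (λ x → T? (closedNbhd G x u ∧ closedNbhd G x v)) ⌋

maxPacking : Graph → ℕ
maxPacking G = maxWeight (plan (packingClash G) (suc ∘ deg G) [] (allFin (V G))) []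

module _ {G : Graph} where

  packingClash-sound : ∀ {u v} → T (packingClash G u v) →
    u ≢ v × ∃ λ x → T (closedNbhd G x u) × T (closedNbhd G x v)
  packingClash-sound {u} {v} clash with Equivalence.to (T-∧ {not ⌊ u ≟ v ⌋}) clash
  ... | distinct , shared with toWitness shared
  ...   | x , x∼u∧v = toWitnessFalse distinct , x , Equivalence.to T-∧ x∼u∧v

  twoPacking⇒clashFree : ∀ {S} → IsTwoPacking G S → ClashFree (packingClash G) S
  twoPacking⇒clashFree {S} twoPacking clash Su Sv with packingClash-sound clash
  ... | u≢v , x , x∼u , x∼v =
    u≢v (count≤1⇒unique (λ y → closedNbhd G x y ∧ S y) (twoPacking x)
          (Equivalence.from T-∧ (x∼u , Su)) (Equivalence.from T-∧ (x∼v , Sv)))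

  weight≤maxPacking : ∀ {S} → IsTwoPacking G S → weight G S ≤ maxPacking G
  weight≤maxPacking {S} twoPacking = subst (_≤ maxPacking G)
    (cong sum (sym (tabulate-allFin (λ v → if S v then suc (deg G v) else 0))))
    (selectedWeight≤maxWeight (packingClash G) (suc ∘ deg G)
      (twoPacking⇒clashFree twoPacking) [] (allFin (V G)))

  effDomNumberIs : ∀ {k} → maxPacking G ≡ k →
    ∀ S → IsTwoPacking G S → weight G S ≡ k → EffDomNumberIs G k
  effDomNumberIs refl S twoPacking weight≡k =
    (S , twoPacking , weight≡k) , λ _ → weight≤maxPacking

  ¬efficientlyDominatable : IsSimple G → ∀ {k} → EffDomNumberIs G k → k < V G →
    ¬ EfficientlyDominatable G
  ¬efficientlyDominatable simple (_ , bound) k<V dominatable =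
    <⇒≱ k<V (efficientlyDominatable⇒V≤ simple dominatable bound)

isTwoPacking? : ∀ G S → Dec (IsTwoPacking G S)
isTwoPacking? G S = all? λ x → nbhdCount G S x ≤? 1

isEfficientDominatingSet? : ∀ G S → Dec (∀ v → nbhdCount G S v ≡ 1)
isEfficientDominatingSet? G S = all? λ v → nbhdCount G S v ℕ.≟ 1

grid : ℕ → Graph
grid n = Path n □ Path n

grid-isSimple : ∀ n → IsSimple (grid n)
grid-isSimple n = □-isSimple (path-isSimple n) (path-isSimple n)

-- combine i j is the vertex that remQuot sends to (i , j), i.e. row i and column j.
cells : ∀ n → List (Fin n × Fin n) → VSet (grid n)
cells n cs v = any (λ (i , j) → ⌊ combine i j ≟ v ⌋) cs

efficientDominatingSet₄ : VSet (grid 4)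
efficientDominatingSet₄ = cells 4 ((# 0 , # 2) ∷ (# 1 , # 0) ∷ (# 2 , # 3) ∷ (# 3 , # 1) ∷ [])

packing₅ : VSet (grid 5)
packing₅ = cells 5 ((# 0 , # 2) ∷ (# 1 , # 0) ∷ (# 1 , # 4) ∷
                    (# 3 , # 2) ∷ (# 4 , # 0) ∷ (# 4 , # 4) ∷ [])

packing₆ : VSet (grid 6)
packing₆ = cells 6 ((# 0 , # 3) ∷ (# 1 , # 0) ∷ (# 1 , # 5) ∷ (# 2 , # 2) ∷
                    (# 3 , # 4) ∷ (# 4 , # 0) ∷ (# 5 , # 2) ∷ (# 5 , # 5) ∷ [])

maxPacking-grid₅ : maxPacking (grid 5) ≡ 23
maxPacking-grid₅ = refl

maxPacking-grid₆ : maxPacking (grid 6) ≡ 33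
maxPacking-grid₆ = refl

effDomNumber-grid₅ : EffDomNumberIs (grid 5) 23
effDomNumber-grid₅ = effDomNumberIs {grid 5} maxPacking-grid₅
  packing₅ (toWitness {a? = isTwoPacking? (grid 5) packing₅} _) refl

effDomNumber-grid₆ : EffDomNumberIs (grid 6) 33
effDomNumber-grid₆ = effDomNumberIs {grid 6} maxPacking-grid₆
  packing₆ (toWitness {a? = isTwoPacking? (grid 6) packing₆} _) refl

mainTheorem3 : EfficientlyDominatable (Path 4 □ Path 4)
    × (¬ EfficientlyDominatable (Path 5 □ Path 5) × EffDomNumberIs (Path 5 □ Path 5) 23)
    × (¬ EfficientlyDominatable (Path 6 □ Path 6) × EffDomNumberIs (Path 6 □ Path 6) 33)
mainTheorem3 =
  (efficientDominatingSet₄ ,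
    toWitness {a? = isEfficientDominatingSet? (grid 4) efficientDominatingSet₄} _)
  , (¬efficientlyDominatable (grid-isSimple 5) effDomNumber-grid₅ (m<m+n 23 z<s) , effDomNumber-grid₅)
  , (¬efficientlyDominatable (grid-isSimple 6) effDomNumber-grid₆ (m<m+n 33 z<s) , effDomNumber-grid₆)
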